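{- The equation $\frac{1}{t_x} + \frac{1}{t_y} = \frac{2}{t_z}$ has infinitely many non-trivial solutions in positive integers $x, y, z$; that is, there are infinitely many non-constant three-term arithmetic progressions of the form $\frac{1}{t_x}, \frac{1}{t_z}, \frac{1}{t_y}$ with $x,y,z$ positive integers.
   Context: $t_n = \frac{n(n+1)}{2}$ denotes the $n$-th triangular number. A solution is non-trivial if it is not of the form $x=y=z$. -}

module Defs where

open import Data.Nat using (ℕ; suc; _*_; _/_; NonZero)
open import Data.Integer using (+_)
open import Data.Rational as ℚ using (ℚ)

-- n-th triangular number t_n = n(n+1)/2  (exact division: n(n+1) is even)
t : ℕ → ℕ
t n = (n * suc n) / 2

recipT : (m : ℕ) → NonZero (t m) → ℚ
recipT m nz = (+ 1) ℚ./ t m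
  where instance _ = nz

module Submission where

-- If 2 t_x = t_z + 1, then y = t_z works: writing a = t_x and c = t_z,
-- the number c is odd with c + 1 = 2a, so t_c = c(c+1)/2 = c·a, and
--   1/a + 1/(c·a) = (c + 1)/(c·a) = 2a/(c·a) = 2/c.
-- The condition 2 t_x = t_z + 1, i.e. 2x(x+1) = z(z+1) + 2, is a Pell-type
-- equation; it has the solution (7, 10), and the linear map
-- (x, z) ↦ (3x + 2z + 2, 4x + 3z + 3) sends solutions to larger solutions.

open import Defs
open import Data.Nat using (ℕ; _+_; _<_; NonZero)
open import Data.Product using (Σ; ∃; _×_)
open import Relation.Nullary using (¬_)
open import Relation.Binary.PropositionalEquality using (_≡_)
open import Data.Rational using (1ℚ) renaming (_+_ to _+ℚ_; _*_ to _*ℚ_)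

open import Data.Nat using (zero; suc; _*_; _/_; s≤s; z≤n; z<s; >-nonZero)
open import Data.Nat.Properties
  using (*-cancelʳ-≡; +-cancelʳ-≡; +-comm; *-assoc; *-distribʳ-+;
         <-trans; <-≤-trans; ≤-<-trans; ≤-trans; m≤m+n; m≤n+m; m<m+n; ≤-reflexive; <-irrefl)
open import Data.Nat.DivMod using (m*n/n≡m)
open import Data.Nat.Tactic.RingSolver using (solve-∀)
open import Data.Integer using (+_)
import Data.Rational as ℚ
open import Data.Rational.Properties
  using (toℚᵘ-injective; toℚᵘ-homo-+; toℚᵘ-homo-*; toℚᵘ-fromℚᵘ)
import Data.Rational.Unnormalised as U
import Data.Rational.Unnormalised.Properties as UP
open import Data.Product using (_,_)
open import Relation.Binary.PropositionalEquality
  using (refl; sym; trans; cong; cong₂; subst; module ≡-Reasoning)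

pronic-even : ∀ n → ∃ λ k → n * suc n ≡ k * 2
pronic-even zero    = 0 , refl
pronic-even (suc n) with pronic-even n
... | k , n[n+1]≡2k = k + suc n , (begin
  suc n * suc (suc n)       ≡⟨ expand n ⟩
  n * suc n + suc n * 2     ≡⟨ cong (_+ suc n * 2) n[n+1]≡2k ⟩
  k * 2 + suc n * 2         ≡⟨ sym (*-distribʳ-+ 2 k (suc n)) ⟩
  (k + suc n) * 2           ∎)
  where
  open ≡-Reasoning
  expand : ∀ n → suc n * suc (suc n) ≡ n * suc n + suc n * 2
  expand = solve-∀

t-double : ∀ n → t n * 2 ≡ n * suc n
t-double n with pronic-even n
... | k , n[n+1]≡2k = begin
  (n * suc n) / 2 * 2   ≡⟨ cong (λ m → m / 2 * 2) n[n+1]≡2k ⟩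
  k * 2 / 2 * 2         ≡⟨ cong (_* 2) (m*n/n≡m k 2) ⟩
  k * 2                 ≡⟨ sym n[n+1]≡2k ⟩
  n * suc n             ∎
  where open ≡-Reasoning

t-positive : ∀ n → 0 < n → 0 < t n
t-positive (suc m) _ with t (suc m) | t-double (suc m)
... | zero  | ()
... | suc _ | _ = z<s

t-nonZero : ∀ n → 0 < n → NonZero (t n)
t-nonZero n 0<n = >-nonZero (t-positive n 0<n)

t-of-odd : ∀ c a → suc c ≡ a * 2 → t c ≡ c * a
t-of-odd c a c+1≡2a = *-cancelʳ-≡ (t c) (c * a) 2 (begin
  t c * 2        ≡⟨ t-double c ⟩
  c * suc c      ≡⟨ cong (c *_) c+1≡2a ⟩
  c * (a * 2)    ≡⟨ sym (*-assoc c a 2) ⟩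
  c * a * 2      ∎)
  where open ≡-Reasoning

-- The proof passes to unnormalised rationals, where both sides are fractions
-- with the explicit cross-multiplication condition.
unit-fractions-harmonic : ∀ A B C .{{_ : NonZero A}} .{{_ : NonZero B}} .{{_ : NonZero C}} →
  C * (A + B) ≡ 2 * A * B →
  (+ 1) ℚ./ A +ℚ (+ 1) ℚ./ B ≡ (1ℚ +ℚ 1ℚ) *ℚ ((+ 1) ℚ./ C)
unit-fractions-harmonic (suc a) (suc b) (suc c) cross = toℚᵘ-injective (begin
  ℚ.toℚᵘ (1/A +ℚ 1/B)                      ≈⟨ toℚᵘ-homo-+ 1/A 1/B ⟩
  ℚ.toℚᵘ 1/A U.+ ℚ.toℚᵘ 1/B                ≈⟨ UP.+-cong (toℚᵘ-fromℚᵘ (U.mkℚᵘ (+ 1) a))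
                                                        (toℚᵘ-fromℚᵘ (U.mkℚᵘ (+ 1) b)) ⟩
  U.mkℚᵘ (+ 1) a U.+ U.mkℚᵘ (+ 1) b        ≈⟨ unnormalised ⟩
  (U.1ℚᵘ U.+ U.1ℚᵘ) U.* U.mkℚᵘ (+ 1) c     ≈⟨ UP.*-cong (UP.≃-sym (toℚᵘ-homo-+ 1ℚ 1ℚ))
                                                        (UP.≃-sym (toℚᵘ-fromℚᵘ (U.mkℚᵘ (+ 1) c))) ⟩
  ℚ.toℚᵘ (1ℚ +ℚ 1ℚ) U.* ℚ.toℚᵘ 1/C         ≈⟨ UP.≃-sym (toℚᵘ-homo-* (1ℚ +ℚ 1ℚ) 1/C) ⟩
  ℚ.toℚᵘ ((1ℚ +ℚ 1ℚ) *ℚ 1/C)               ∎)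
  where
  open UP.≃-Reasoning
  1/A = (+ 1) ℚ./ suc a
  1/B = (+ 1) ℚ./ suc b
  1/C = (+ 1) ℚ./ suc c

  lhs-numerator : ∀ A B C → (1 * B + 1 * A) * (1 * C) ≡ C * (A + B)
  lhs-numerator = solve-∀
  rhs-numerator : ∀ A B → 2 * A * B ≡ 2 * (A * B)
  rhs-numerator = solve-∀

  unnormalised : U.mkℚᵘ (+ 1) a U.+ U.mkℚᵘ (+ 1) b U.≃ (U.1ℚᵘ U.+ U.1ℚᵘ) U.* U.mkℚᵘ (+ 1) c
  unnormalised = U.*≡* (cong +_ (trans (lhs-numerator (suc a) (suc b) (suc c))
                                (trans cross (rhs-numerator (suc a) (suc b)))))

odd-triangle-harmonic : ∀ c a → suc c ≡ a * 2 → c * (a + t c) ≡ 2 * a * t c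
odd-triangle-harmonic c a c+1≡2a = begin
  c * (a + t c)        ≡⟨ cong (λ w → c * (a + w)) t-c ⟩
  c * (a + c * a)      ≡⟨ factor c a ⟩
  c * a * suc c        ≡⟨ cong (c * a *_) c+1≡2a ⟩
  c * a * (a * 2)      ≡⟨ regroup c a ⟩
  2 * a * (c * a)      ≡⟨ cong (2 * a *_) (sym t-c) ⟩
  2 * a * t c          ∎
  where
  open ≡-Reasoning
  t-c : t c ≡ c * a
  t-c = t-of-odd c a c+1≡2a
  factor : ∀ c a → c * (a + c * a) ≡ c * a * suc c
  factor = solve-∀
  regroup : ∀ c a → c * a * (a * 2) ≡ 2 * a * (c * a)
  regroup = solve-∀

Balanced : ℕ → ℕ → Set
Balanced x z = x * suc x + x * suc x ≡ z * suc z + 2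

balanced⇒triangular : ∀ x z → Balanced x z → suc (t z) ≡ t x * 2
balanced⇒triangular x z balanced = *-cancelʳ-≡ (suc (t z)) (t x * 2) 2 (sym (begin
  t x * 2 * 2                   ≡⟨ double (t x * 2) ⟩
  t x * 2 + t x * 2             ≡⟨ cong₂ _+_ (t-double x) (t-double x) ⟩
  x * suc x + x * suc x         ≡⟨ balanced ⟩
  z * suc z + 2                 ≡⟨ cong (_+ 2) (sym (t-double z)) ⟩
  t z * 2 + 2                   ≡⟨ +-comm (t z * 2) 2 ⟩
  suc (t z) * 2                 ∎))
  where
  open ≡-Reasoning
  double : ∀ m → m * 2 ≡ m + m
  double = solve-∀

next-x next-z : ℕ → ℕ → ℕ
next-x x z = 3 * x + 2 * z + 2
next-z x z = 4 * x + 3 * z + 3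

next-balanced : ∀ x z → Balanced x z → Balanced (next-x x z) (next-z x z)
next-balanced x z balanced = +-cancelʳ-≡ (z * suc z) _ _ (begin
  x' * suc x' + x' * suc x' + z * suc z   ≡⟨ invariant x z ⟩
  z' * suc z' + (x * suc x + x * suc x)   ≡⟨ cong (_+_ (z' * suc z')) balanced ⟩
  z' * suc z' + (z * suc z + 2)           ≡⟨ regroup z' z ⟩
  z' * suc z' + 2 + z * suc z             ∎)
  where
  open ≡-Reasoning
  x' = next-x x z
  z' = next-z x z
  -- the quadratic form 2x(x+1) - z(z+1) is preserved by the map
  invariant : ∀ x z →
    (3 * x + 2 * z + 2) * suc (3 * x + 2 * z + 2) + (3 * x + 2 * z + 2) * suc (3 * x + 2 * z + 2)
      + z * suc z
    ≡ (4 * x + 3 * z + 3) * suc (4 * x + 3 * z + 3) + (x * suc x + x * suc x)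
  invariant = solve-∀
  regroup : ∀ a z → a * suc a + (z * suc z + 2) ≡ a * suc a + 2 + z * suc z
  regroup = solve-∀

-- A solution of the equation with x < z (forcing non-triviality) and x > n.
record LargeSolution (n : ℕ) : Set where
  field
    x z      : ℕ
    balanced : Balanced x z
    x<z      : x < z
    n<x      : n < x

next-solution : ∀ {n} → LargeSolution n → LargeSolution (suc n)
next-solution {n} s = record
  { x = next-x x z ; z = next-z x z
  ; balanced = next-balanced x z balanced
  ; x<z = subst (next-x x z <_) (gap x z) (m<m+n (next-x x z) z<s)
  ; n<x = <-≤-trans (s≤s n<x) (≤-trans (m≤n+m (suc x) (2 * x + 2 * z + 1))
                                        (≤-reflexive (growth x z)))
  }
  where
  open LargeSolution s
  gap : ∀ x z → 3 * x + 2 * z + 2 + suc (x + z) ≡ 4 * x + 3 * z + 3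
  gap = solve-∀
  growth : ∀ x z → 2 * x + 2 * z + 1 + suc x ≡ 3 * x + 2 * z + 2
  growth = solve-∀

large-solution : ∀ n → LargeSolution n
large-solution zero    = record { x = 7 ; z = 10 ; balanced = refl
                                ; x<z = s≤s (s≤s (s≤s (s≤s (s≤s (s≤s (s≤s (s≤s z≤n)))))))
                                ; n<x = z<s }
large-solution (suc n) = next-solution (large-solution n)

theorem4p1 : ∀ (N : ℕ) → ∃ λ x → ∃ λ y → ∃ λ z →
    (0 < x) × (0 < y) × (0 < z) × (N < x + y + z) × ¬ ((x ≡ y) × (y ≡ z)) ×
    Σ (NonZero (t x)) λ nx → Σ (NonZero (t y)) λ ny → Σ (NonZero (t z)) λ nz →
    recipT x nx +ℚ recipT y ny ≡ (1ℚ +ℚ 1ℚ) *ℚ recipT z nz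
theorem4p1 N =
  x , t z , z , 0<x , 0<tz , 0<z , large , nonconstant ,
  t-nonZero x 0<x , t-nonZero (t z) 0<tz , t-nonZero z 0<z ,
  unit-fractions-harmonic (t x) (t (t z)) (t z)
    {{t-nonZero x 0<x}} {{t-nonZero (t z) 0<tz}} {{t-nonZero z 0<z}}
    (odd-triangle-harmonic (t z) (t x) (balanced⇒triangular x z balanced))
  where
  open LargeSolution (large-solution N)
  0<x : 0 < x
  0<x = ≤-<-trans z≤n n<x
  0<z : 0 < z
  0<z = <-trans 0<x x<z
  0<tz : 0 < t z
  0<tz = t-positive z 0<z
  large : N < x + t z + z
  large = <-≤-trans n<x (≤-trans (m≤m+n x (t z)) (m≤m+n (x + t z) z))
  nonconstant : ¬ ((x ≡ t z) × (t z ≡ z))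
  nonconstant (x≡y , y≡z) = <-irrefl (trans x≡y y≡z) x<z
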